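{- If $\vdash_0 P$, then there is no $P'$ such that $P\xrightarrow{\tau}P'$ and this transition is an interaction.
   Context: Asynchronous $\pi$-calculus: processes $P ::= a\langle\tilde b\rangle \mid\ !a(\tilde b).P \mid P|Q \mid (\nu a)P \mid G$, $G ::= \mathbf 0 \mid a(\tilde b).P \mid \tau.P \mid [a=b]G \mid G+G'$, well-sorted under a fixed sorting; $\xrightarrow{\mu}$ is the standard early LTS of the asynchronous $\pi$-calculus. A reduction $P\xrightarrow{\tau}P'$ is an interaction if its derivation uses the communication rule (synchronisation of an input with an output). Names are partitioned into output-controlled ($x,y,z$) and input-controlled ($u,v,w$). Judgements $\vdash_\eta P$, $\eta\in\{0,1\}$: $\vdash_1 u(\tilde a).P$ if $\vdash_1P$; $\vdash_0 x(\tilde a).P$, $\vdash_0 !x(\tilde a).P$ if $\vdash_1P$; $\vdash_1x\langle\tilde a\rangle$; $\vdash_0u\langle\tilde a\rangle$; $\vdash_\eta(\nu a)P$ if $\vdash_\eta P$; $\vdash_0\mathbf0$; $\vdash_{\eta_1+\eta_2}P|Q$ if $\vdash_{\eta_1}P$, $\vdash_{\eta_2}Q$, $\eta_1+\eta_2\le1$; $\vdash_\eta G_1+G_2$ if $\vdash_\eta G_1,G_2$; $\vdash_\eta\tau.P$ if $\vdash_\eta P$; $\vdash_0[a=b]G$ if $\vdash_0G$. -}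

module Defs where

open import Data.Nat using (ℕ; _+_; _≤_)
open import Data.List using (List; []; _∷_; _++_)
open import Data.List.Membership.Propositional using (_∈_)
open import Data.List.Relation.Unary.Any using (here; there)
open import Data.List.Relation.Unary.All as All using (All; []; _∷_)
open import Data.Empty using (⊥)
open import Data.Unit using (⊤)
open import Data.Sum using (_⊎_)
open import Relation.Binary.PropositionalEquality using (_≡_; refl; sym; subst)

-- The partition of names: output-controlled (x,y,z) / input-controlled (u,v,w).
data Kind : Set where
  oc ic : Kind

-- Each sort has an object sort list (the sorts of the names
-- carried) and a kind; names of a sort all lie in the same block of the
-- partition (the partition is compatible with the sorting).
record Sorting : Set₁ where
  field
    Sort : Set
    ob   : Sort → List Sort
    kind : Sort → Kind

module Pi (𝒮 : Sorting) where
  open Sorting 𝒮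

  -- Contexts of (sorted) names, de Bruijn style: a name of sort s in Γ is s ∈ Γ.
  Ctx : Set
  Ctx = List Sort

  Names : Ctx → List Sort → Set
  Names Γ ss = All (_∈ Γ) ss

  _⊕_ : Ctx → Ctx → Ctx
  [] ⊕ Γ = Γ
  (s ∷ Δ) ⊕ Γ = Δ ⊕ (s ∷ Γ)

  -- Well-sorted processes (intrinsically sorted syntax).
  -- Binding: an input a(b̃).P with a of sort s binds ob s, so P lives in ob s ++ Γ.
  mutual
    data Proc (Γ : Ctx) : Set where
      out : ∀ {s} → s ∈ Γ → Names Γ (ob s) → Proc Γ
      rep : ∀ {s} → s ∈ Γ → Proc (ob s ++ Γ) → Proc Γ
      par : Proc Γ → Proc Γ → Proc Γ
      new : (s : Sort) → Proc (s ∷ Γ) → Proc Γ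
      grd : Guard Γ → Proc Γ

    data Guard (Γ : Ctx) : Set where
      nil   : Guard Γ
      inp   : ∀ {s} → s ∈ Γ → Proc (ob s ++ Γ) → Guard Γ
      tau   : Proc Γ → Guard Γ
      match : ∀ {s t} → s ∈ Γ → t ∈ Γ → Guard Γ → Guard Γ
      sum   : Guard Γ → Guard Γ → Guard Γ

  Ren : Ctx → Ctx → Set
  Ren Γ Δ = ∀ {s} → s ∈ Γ → s ∈ Δ

  liftL : ∀ Ξ {Γ Δ} → Ren Γ Δ → Ren (Ξ ++ Γ) (Ξ ++ Δ)
  liftL []      ρ i         = ρ i
  liftL (x ∷ Ξ) ρ (here p)  = here p
  liftL (x ∷ Ξ) ρ (there i) = there (liftL Ξ ρ i)

  mutual
    ren : ∀ {Γ Δ} → Ren Γ Δ → Proc Γ → Proc Δ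
    ren ρ (out a bs)  = out (ρ a) (All.map ρ bs)
    ren ρ (rep {s} a P) = rep (ρ a) (ren (liftL (ob s) ρ) P)
    ren ρ (par P Q)   = par (ren ρ P) (ren ρ Q)
    ren ρ (new s P)   = new s (ren (liftL (s ∷ []) ρ) P)
    ren ρ (grd G)     = grd (renG ρ G)

    renG : ∀ {Γ Δ} → Ren Γ Δ → Guard Γ → Guard Δ
    renG ρ nil           = nil
    renG ρ (inp {s} a P) = inp (ρ a) (ren (liftL (ob s) ρ) P)
    renG ρ (tau P)       = tau (ren ρ P)
    renG ρ (match a b G) = match (ρ a) (ρ b) (renG ρ G)
    renG ρ (sum G H)     = sum (renG ρ G) (renG ρ H)

  inst : ∀ {Γ ss} → Names Γ ss → Ren (ss ++ Γ) Γ
  inst []       i         = i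
  inst (b ∷ bs) (here p)  = subst (_∈ _) (sym p) b
  inst (b ∷ bs) (there i) = inst bs i

  wk⊕ : ∀ Δ {Γ} → Ren Γ (Δ ⊕ Γ)
  wk⊕ []      i = i
  wk⊕ (t ∷ Δ) i = wk⊕ Δ (there i)

  mapUnder : ∀ Δ {Γ Γ'} → Ren Γ Γ' → Ren (Δ ⊕ Γ) (Δ ⊕ Γ')
  mapUnder []      ρ = ρ
  mapUnder (t ∷ Δ) ρ = mapUnder Δ (liftL (t ∷ []) ρ)

  swap01 : ∀ {s t Γ} → Ren (t ∷ s ∷ Γ) (s ∷ t ∷ Γ)
  swap01 (here p)          = there (here p)
  swap01 (there (here p))  = here p
  swap01 (there (there i)) = there (there i)

  swapOut : ∀ Δ {s Γ} → Ren (Δ ⊕ (s ∷ Γ)) (s ∷ (Δ ⊕ Γ))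
  swapOut []      i = i
  swapOut (t ∷ Δ) i = swapOut Δ (mapUnder Δ swap01 i)

  pos : ∀ Δ {s Γ} → s ∈ Δ ⊕ (s ∷ Γ)
  pos Δ = wk⊕ Δ (here refl)

  same : ∀ {Γ : Ctx} {s t : Sort} → s ∈ Γ → t ∈ Γ → Set
  same (here _)  (here _)  = ⊤
  same (here _)  (there _) = ⊥
  same (there _) (here _)  = ⊥
  same (there i) (there j) = same i j

  Occurs : ∀ {Γ : Ctx} {t : Sort} {ss : List Sort} → t ∈ Γ → Names Γ ss → Set
  Occurs n []       = ⊥
  Occurs n (m ∷ ms) = same n m ⊎ Occurs n ms

  news : ∀ Δ {Γ} → Proc (Δ ⊕ Γ) → Proc Γ
  news []      P = P
  news (t ∷ Δ) P = new t (news Δ P)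

  -- Actions of the early LTS.  An output  out Δ a b̃  is  ā(νΔ)b̃ : the names
  -- Δ are extruded (bound output), and b̃ lives in Δ ⊕ Γ.
  data Act (Γ : Ctx) : Set where
    τ   : Act Γ
    inp : ∀ {s} → s ∈ Γ → Names Γ (ob s) → Act Γ
    out : (Δ : Ctx) → ∀ {s} → s ∈ Γ → Names (Δ ⊕ Γ) (ob s) → Act Γ

  tgt : ∀ {Γ} → Act Γ → Ctx
  tgt {Γ} τ          = Γ
  tgt {Γ} (inp _ _)  = Γ
  tgt {Γ} (out Δ _ _) = Δ ⊕ Γ

  wkAct : ∀ {Γ s} → Act Γ → Act (s ∷ Γ)
  wkAct τ            = τ
  wkAct (inp a bs)   = inp (there a) (All.map there bs)
  wkAct (out Δ a bs) = out Δ (there a) (All.map (mapUnder Δ there) bs)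

  wkTgt : ∀ {Γ} (α : Act Γ) → Proc Γ → Proc (tgt α)
  wkTgt τ            Q = Q
  wkTgt (inp _ _)    Q = Q
  wkTgt (out Δ _ _)  Q = ren (wk⊕ Δ) Q

  resTgt : ∀ {Γ s} (α : Act Γ) → Proc (tgt (wkAct {Γ} {s} α)) → Proc (tgt α)
  resTgt {s = s} τ            P = new s P
  resTgt {s = s} (inp _ _)    P = new s P
  resTgt {s = s} (out Δ _ _)  P = new s (ren (swapOut Δ) P)

  data _—[_]→_ : ∀ {Γ} → Proc Γ → (α : Act Γ) → Proc (tgt α) → Set where
    OUT   : ∀ {Γ s} {a : s ∈ Γ} {bs} →
            out a bs —[ out [] a bs ]→ grd nil
    INP   : ∀ {Γ s} {a : s ∈ Γ} {P bs} →
            grd (inp a P) —[ inp a bs ]→ ren (inst bs) P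
    REP   : ∀ {Γ s} {a : s ∈ Γ} {P bs} →
            rep a P —[ inp a bs ]→ par (ren (inst bs) P) (rep a P)
    TAU   : ∀ {Γ} {P : Proc Γ} →
            grd (tau P) —[ τ ]→ P
    MATCH : ∀ {Γ s} {a : s ∈ Γ} {G α Q} →
            grd G —[ α ]→ Q → grd (match a a G) —[ α ]→ Q
    SUMl  : ∀ {Γ} {G H : Guard Γ} {α Q} →
            grd G —[ α ]→ Q → grd (sum G H) —[ α ]→ Q
    SUMr  : ∀ {Γ} {G H : Guard Γ} {α Q} →
            grd H —[ α ]→ Q → grd (sum G H) —[ α ]→ Q
    PARl  : ∀ {Γ} {P Q : Proc Γ} {α P'} →
            P —[ α ]→ P' → par P Q —[ α ]→ par P' (wkTgt α Q)
    PARr  : ∀ {Γ} {P Q : Proc Γ} {α Q'} →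
            Q —[ α ]→ Q' → par P Q —[ α ]→ par (wkTgt α P) Q'
    -- communication (with scope extrusion / close when Δ ≠ [])
    COMMl : ∀ {Γ Δ s} {P Q : Proc Γ} {a : s ∈ Γ} {bs P' Q'} →
            P —[ out Δ a bs ]→ P' →
            ren (wk⊕ Δ) Q —[ inp (wk⊕ Δ a) bs ]→ Q' →
            par P Q —[ τ ]→ news Δ (par P' Q')
    COMMr : ∀ {Γ Δ s} {P Q : Proc Γ} {a : s ∈ Γ} {bs P' Q'} →
            ren (wk⊕ Δ) P —[ inp (wk⊕ Δ a) bs ]→ P' →
            Q —[ out Δ a bs ]→ Q' →
            par P Q —[ τ ]→ news Δ (par P' Q')
    RES   : ∀ {Γ s} {P : Proc (s ∷ Γ)} {α : Act Γ} {P'} →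
            P —[ wkAct α ]→ P' → new s P —[ α ]→ resTgt α P'
    OPEN  : ∀ {Γ Δ s t} {P : Proc (s ∷ Γ)} {a : t ∈ Γ}
              {bs : Names (Δ ⊕ (s ∷ Γ)) (ob t)} {P'} →
            Occurs (pos Δ) bs →
            P —[ out Δ (there a) bs ]→ P' →
            new s P —[ out (s ∷ Δ) a bs ]→ P'

  Interaction : ∀ {Γ} {P : Proc Γ} {α P'} → P —[ α ]→ P' → Set
  Interaction OUT         = ⊥
  Interaction INP         = ⊥
  Interaction REP         = ⊥
  Interaction TAU         = ⊥
  Interaction (MATCH d)   = Interaction d
  Interaction (SUMl d)    = Interaction d
  Interaction (SUMr d)    = Interaction d
  Interaction (PARl d)    = Interaction d
  Interaction (PARr d)    = Interaction d
  Interaction (COMMl _ _) = ⊤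
  Interaction (COMMr _ _) = ⊤
  Interaction (RES d)     = Interaction d
  Interaction (OPEN _ d)  = Interaction d

  mutual
    data ⊢[_]_ : ∀ {Γ} → ℕ → Proc Γ → Set where
      t-rep   : ∀ {Γ s} {a : s ∈ Γ} {P} → kind s ≡ oc →
                ⊢[ 1 ] P → ⊢[ 0 ] rep a P
      t-out-o : ∀ {Γ s} {a : s ∈ Γ} {bs} → kind s ≡ oc → ⊢[ 1 ] out a bs
      t-out-i : ∀ {Γ s} {a : s ∈ Γ} {bs} → kind s ≡ ic → ⊢[ 0 ] out a bs
      t-new   : ∀ {Γ s η} {P : Proc (s ∷ Γ)} → ⊢[ η ] P → ⊢[ η ] new s P
      t-par   : ∀ {Γ η₁ η₂} {P Q : Proc Γ} → η₁ + η₂ ≤ 1 →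
                ⊢[ η₁ ] P → ⊢[ η₂ ] Q → ⊢[ η₁ + η₂ ] par P Q
      t-grd   : ∀ {Γ η} {G : Guard Γ} → ⊢g[ η ] G → ⊢[ η ] grd G

    data ⊢g[_]_ : ∀ {Γ} → ℕ → Guard Γ → Set where
      t-inp-i : ∀ {Γ s} {a : s ∈ Γ} {P} → kind s ≡ ic →
                ⊢[ 1 ] P → ⊢g[ 1 ] inp a P
      t-inp-o : ∀ {Γ s} {a : s ∈ Γ} {P} → kind s ≡ oc →
                ⊢[ 1 ] P → ⊢g[ 0 ] inp a P
      t-nil   : ∀ {Γ} → ⊢g[ 0 ] (nil {Γ})
      t-sum   : ∀ {Γ η} {G H : Guard Γ} → ⊢g[ η ] G → ⊢g[ η ] H → ⊢g[ η ] sum G H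
      t-tau   : ∀ {Γ η} {P : Proc Γ} → ⊢[ η ] P → ⊢g[ η ] tau P
      t-match : ∀ {Γ s t} {a : s ∈ Γ} {b : t ∈ Γ} {G} →
                ⊢g[ 0 ] G → ⊢g[ 0 ] match a b G

{-# OPTIONS --safe #-}
module Submission where

open import Defs
open import Data.Product using (Σ; _,_)
open import Relation.Nullary using (¬_)
open import Data.Nat.Properties using (m+n≡0⇒m≡0; m+n≡0⇒n≡0)
open import Data.Empty using (⊥)
open import Data.List using ([]; _∷_)
open import Data.List.Membership.Propositional using (_∈_)
open import Data.Unit using (⊤; tt)
open import Relation.Binary.PropositionalEquality using (_≡_; refl; sym; trans)

-- A process typed ⊢₀ owns neither the input capability of an input-controlled
-- name nor the output capability of an output-controlled one: every output it
-- can perform is on an input-controlled name and every input on an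
-- output-controlled name.  Both parallel components of a ⊢₀ process are ⊢₀,
-- so a communication between them would need a name of both kinds.

module _ (𝒮 : Sorting) where
  open Sorting 𝒮
  open Pi 𝒮

  mutual
    ⊢-ren : ∀ {Γ Δ η} (ρ : Ren Γ Δ) {P : Proc Γ} → ⊢[ η ] P → ⊢[ η ] ren ρ P
    ⊢-ren ρ (t-rep {s = s} k p) = t-rep k (⊢-ren (liftL (ob s) ρ) p)
    ⊢-ren ρ (t-out-o k)         = t-out-o k
    ⊢-ren ρ (t-out-i k)         = t-out-i k
    ⊢-ren ρ (t-new {s = s} p)   = t-new (⊢-ren (liftL (s ∷ []) ρ) p)
    ⊢-ren ρ (t-par le p q)      = t-par le (⊢-ren ρ p) (⊢-ren ρ q)
    ⊢-ren ρ (t-grd g)           = t-grd (⊢g-ren ρ g)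

    ⊢g-ren : ∀ {Γ Δ η} (ρ : Ren Γ Δ) {G : Guard Γ} → ⊢g[ η ] G → ⊢g[ η ] renG ρ G
    ⊢g-ren ρ (t-inp-i {s = s} k p) = t-inp-i k (⊢-ren (liftL (ob s) ρ) p)
    ⊢g-ren ρ (t-inp-o {s = s} k p) = t-inp-o k (⊢-ren (liftL (ob s) ρ) p)
    ⊢g-ren ρ t-nil                 = t-nil
    ⊢g-ren ρ (t-sum g h)           = t-sum (⊢g-ren ρ g) (⊢g-ren ρ h)
    ⊢g-ren ρ (t-tau p)             = t-tau (⊢-ren ρ p)
    ⊢g-ren ρ (t-match g)           = t-match (⊢g-ren ρ g)

  OutputsOn : Kind → ∀ {Γ} → Act Γ → Set
  OutputsOn k (out Δ {s} a bs) = kind s ≡ k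
  OutputsOn k _                = ⊤

  InputsOn : Kind → ∀ {Γ} → Act Γ → Set
  InputsOn k (inp {s} a bs) = kind s ≡ k
  InputsOn k _              = ⊤

  outputsOn-wkAct : ∀ {k Γ t} (α : Act Γ) → OutputsOn k (wkAct {Γ} {t} α) → OutputsOn k α
  outputsOn-wkAct τ           o = o
  outputsOn-wkAct (inp _ _)   o = o
  outputsOn-wkAct (out _ _ _) o = o

  inputsOn-wkAct : ∀ {k Γ t} (α : Act Γ) → InputsOn k (wkAct {Γ} {t} α) → InputsOn k α
  inputsOn-wkAct τ           i = i
  inputsOn-wkAct (inp _ _)   i = i
  inputsOn-wkAct (out _ _ _) i = i

  -- The typing index is kept general (with η ≡ 0 as a hypothesis) because
  -- t-par types P | Q at η₁ + η₂, which does not unify with 0.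
  ⊢₀-outputsOn-ic : ∀ {Γ η} {P : Proc Γ} {α P'} →
                    ⊢[ η ] P → η ≡ 0 → P —[ α ]→ P' → OutputsOn ic α
  ⊢₀-outputsOn-ic (t-out-o k) ()  OUT
  ⊢₀-outputsOn-ic (t-out-i k) _   OUT = k
  ⊢₀-outputsOn-ic _           _   INP = tt
  ⊢₀-outputsOn-ic _           _   REP = tt
  ⊢₀-outputsOn-ic _           _   TAU = tt
  ⊢₀-outputsOn-ic (t-grd (t-match g)) e (MATCH d) = ⊢₀-outputsOn-ic (t-grd g) e d
  ⊢₀-outputsOn-ic (t-grd (t-sum g h)) e (SUMl d)  = ⊢₀-outputsOn-ic (t-grd g) e d
  ⊢₀-outputsOn-ic (t-grd (t-sum g h)) e (SUMr d)  = ⊢₀-outputsOn-ic (t-grd h) e d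
  ⊢₀-outputsOn-ic (t-par {η₁ = η₁} _ p q) e (PARl d) = ⊢₀-outputsOn-ic p (m+n≡0⇒m≡0 η₁ e) d
  ⊢₀-outputsOn-ic (t-par {η₁ = η₁} _ p q) e (PARr d) = ⊢₀-outputsOn-ic q (m+n≡0⇒n≡0 η₁ e) d
  ⊢₀-outputsOn-ic _           _   (COMMl _ _) = tt
  ⊢₀-outputsOn-ic _           _   (COMMr _ _) = tt
  ⊢₀-outputsOn-ic (t-new p) e (RES {α = α} d) = outputsOn-wkAct α (⊢₀-outputsOn-ic p e d)
  ⊢₀-outputsOn-ic (t-new p) e (OPEN _ d)      = ⊢₀-outputsOn-ic p e d

  ⊢₀-inputsOn-oc : ∀ {Γ η} {P : Proc Γ} {α P'} →
                   ⊢[ η ] P → η ≡ 0 → P —[ α ]→ P' → InputsOn oc α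
  ⊢₀-inputsOn-oc _                       _  OUT = tt
  ⊢₀-inputsOn-oc (t-grd (t-inp-i k p))   () INP
  ⊢₀-inputsOn-oc (t-grd (t-inp-o k p))   _  INP = k
  ⊢₀-inputsOn-oc (t-rep k p)             _  REP = k
  ⊢₀-inputsOn-oc _                       _  TAU = tt
  ⊢₀-inputsOn-oc (t-grd (t-match g)) e (MATCH d) = ⊢₀-inputsOn-oc (t-grd g) e d
  ⊢₀-inputsOn-oc (t-grd (t-sum g h)) e (SUMl d)  = ⊢₀-inputsOn-oc (t-grd g) e d
  ⊢₀-inputsOn-oc (t-grd (t-sum g h)) e (SUMr d)  = ⊢₀-inputsOn-oc (t-grd h) e d
  ⊢₀-inputsOn-oc (t-par {η₁ = η₁} _ p q) e (PARl d) = ⊢₀-inputsOn-oc p (m+n≡0⇒m≡0 η₁ e) d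
  ⊢₀-inputsOn-oc (t-par {η₁ = η₁} _ p q) e (PARr d) = ⊢₀-inputsOn-oc q (m+n≡0⇒n≡0 η₁ e) d
  ⊢₀-inputsOn-oc _                       _  (COMMl _ _) = tt
  ⊢₀-inputsOn-oc _                       _  (COMMr _ _) = tt
  ⊢₀-inputsOn-oc (t-new p) e (RES {α = α} d) = inputsOn-wkAct α (⊢₀-inputsOn-oc p e d)
  ⊢₀-inputsOn-oc (t-new p) e (OPEN _ d)      = tt

  ⊢₀-¬comm : ∀ {Γ Δ s η₁ η₂} {P Q : Proc Γ} {a : s ∈ Γ} {bs P' Q'} →
             ⊢[ η₁ ] P → η₁ ≡ 0 → ⊢[ η₂ ] Q → η₂ ≡ 0 →
             P —[ out Δ a bs ]→ P' → ren (wk⊕ Δ) Q —[ inp (wk⊕ Δ a) bs ]→ Q' → ⊥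
  ⊢₀-¬comm {Δ = Δ} p e₁ q e₂ dP dQ
    with trans (sym (⊢₀-outputsOn-ic p e₁ dP)) (⊢₀-inputsOn-oc (⊢-ren (wk⊕ Δ) q) e₂ dQ)
  ... | ()

  ⊢₀-¬interaction : ∀ {Γ η} {P : Proc Γ} {α P'} →
                    ⊢[ η ] P → η ≡ 0 → (d : P —[ α ]→ P') → ¬ Interaction d
  ⊢₀-¬interaction (t-grd (t-match g)) e (MATCH d) = ⊢₀-¬interaction (t-grd g) e d
  ⊢₀-¬interaction (t-grd (t-sum g h)) e (SUMl d)  = ⊢₀-¬interaction (t-grd g) e d
  ⊢₀-¬interaction (t-grd (t-sum g h)) e (SUMr d)  = ⊢₀-¬interaction (t-grd h) e d
  ⊢₀-¬interaction (t-par {η₁ = η₁} _ p q) e (PARl d) = ⊢₀-¬interaction p (m+n≡0⇒m≡0 η₁ e) d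
  ⊢₀-¬interaction (t-par {η₁ = η₁} _ p q) e (PARr d) = ⊢₀-¬interaction q (m+n≡0⇒n≡0 η₁ e) d
  ⊢₀-¬interaction (t-par {η₁ = η₁} _ p q) e (COMMl dP dQ) _ =
    ⊢₀-¬comm p (m+n≡0⇒m≡0 η₁ e) q (m+n≡0⇒n≡0 η₁ e) dP dQ
  ⊢₀-¬interaction (t-par {η₁ = η₁} _ p q) e (COMMr dP dQ) _ =
    ⊢₀-¬comm q (m+n≡0⇒n≡0 η₁ e) p (m+n≡0⇒m≡0 η₁ e) dQ dP
  ⊢₀-¬interaction (t-new p) e (RES d)    = ⊢₀-¬interaction p e d
  ⊢₀-¬interaction (t-new p) e (OPEN _ d) = ⊢₀-¬interaction p e d

mainTheorem5 : (𝒮 : Sorting) → let open Pi 𝒮 in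
    ∀ {Γ} (P : Proc Γ) → ⊢[ 0 ] P →
      ¬ (Σ (Proc Γ) λ P' → Σ (P —[ τ ]→ P') λ d → Interaction d)
mainTheorem5 𝒮 P ⊢P (P' , d , i) = ⊢₀-¬interaction 𝒮 ⊢P refl d i
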